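{- For every $n\in\mathbb{Z}^+$ and every set $S$ of positive integers, there is a bijection between $\mathrm{FR}^{\mathrm{T2}}_{n,S}$ and $\mathrm{UPF}^{\mathrm{T2}}_{n,S}$.
   Context: A Fubini ranking of length $n$ is a tuple $(b_1,\dots,b_n)\in[n]^n$ that satisfies two conditions. First, some $b_i$ equals $1$. Second, for every value $x$ occurring exactly $k>0$ times, the next larger value occurring in the tuple (if there is one) is $x+k$. $\mathrm{FR}^{\mathrm{T2}}_{n,S}$ is the set of Fubini rankings of length $n$ in which every value that occurs has its number of occurrences in $S$. A parking preference $(a_1,\dots,a_n)\in[n]^n$ describes $n$ cars entering a one-way street with spots $1,\dots,n$ in the order $1,\dots,n$; car $i$ parks in the first unoccupied spot numbered $\ge a_i$. It is a parking function if all cars park. It is a unit interval parking function if it is a parking function and every car $i$ parks in spot $a_i$ or spot $a_i+1$. Block structure: let $\alpha^{\uparrow}=(a_1',\dots,a_n')$ be the weakly increasing rearrangement of $\alpha$. The indices $i$ with $a'_i=i$ are block starts; the block structure $\pi_1|\cdots|\pi_k$ cuts $\alpha^{\uparrow}$ into consecutive segments, each beginning at a block start. $\mathrm{UPF}^{\mathrm{T2}}_{n,S}$ is the set of unit interval parking functions of length $n$ all of whose blocks have size in $S$. -}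

module Defs where

open import Data.Nat using (ℕ; zero; suc; _+_; _∸_; _≤_; _<_; _≟_; _<ᵇ_)
open import Data.Nat.Properties using (≤-decTotalOrder)
open import Data.List using (List; []; _∷_; length; lookup)
open import Data.List.Membership.DecPropositional _≟_ using (_∈?_)
open import Data.Bool using (Bool; true; false; if_then_else_)
open import Data.Maybe using (Maybe; just; nothing)
open import Data.Product using (_×_; ∃; Σ-syntax)
open import Data.Sum using (_⊎_)
open import Data.Fin using (Fin; toℕ)
open import Relation.Nullary using (¬_; does)
open import Relation.Binary.PropositionalEquality using (_≡_)
import Data.List.Sort.InsertionSort as IS

InRange : ℕ → ℕ → Set
InRange n x = 1 ≤ x × x ≤ n

IsTuple : ℕ → List ℕ → Set
IsTuple n xs = length xs ≡ n × (∀ (i : Fin (length xs)) → InRange n (lookup xs i))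

count : ℕ → List ℕ → ℕ
count x [] = 0
count x (y ∷ ys) = if does (x ≟ y) then suc (count x ys) else count x ys

Occurs : List ℕ → ℕ → Set
Occurs xs x = 0 < count x xs

NextLarger : List ℕ → ℕ → ℕ → Set
NextLarger xs x y = Occurs xs y × x < y × (∀ z → Occurs xs z → x < z → y ≤ z)

IsFubiniRanking : ℕ → List ℕ → Set
IsFubiniRanking n b =
  IsTuple n b
  × Occurs b 1
  × (∀ x y → Occurs b x → NextLarger b x y → y ≡ x + count x b)

IsFRT2 : ℕ → (ℕ → Set) → List ℕ → Set
IsFRT2 n S b = IsFubiniRanking n b × (∀ x → Occurs b x → S (count x b))

findSpot : ℕ → List ℕ → ℕ → ℕ → Maybe ℕ
findSpot n occ a zero = nothing
findSpot n occ a (suc fuel) =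
  if n <ᵇ a then nothing
  else (if does (a ∈? occ) then findSpot n occ (suc a) fuel else just a)

parkAll : ℕ → List ℕ → List ℕ → List (Maybe ℕ)
parkAll n occ [] = []
parkAll n occ (a ∷ as) with findSpot n occ a (suc n)
... | nothing = nothing ∷ parkAll n occ as
... | just s  = just s ∷ parkAll n (s ∷ occ) as

outcome : ℕ → List ℕ → List (Maybe ℕ)
outcome n α = parkAll n [] α

_!?_ : {A : Set} → List A → ℕ → Maybe A
[] !? _ = nothing
(x ∷ xs) !? zero = just x
(x ∷ xs) !? suc k = xs !? k

IsParkingFunction : ℕ → List ℕ → Set
IsParkingFunction n α =
  IsTuple n α
  × (∀ (i : Fin (length α)) → ∃ λ s → (outcome n α !? toℕ i) ≡ just (just s))

IsUnitIntervalPF : ℕ → List ℕ → Set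
IsUnitIntervalPF n α =
  IsParkingFunction n α
  × (∀ (i : Fin (length α)) → ∃ λ s →
       (outcome n α !? toℕ i) ≡ just (just s)
       × (s ≡ lookup α i ⊎ s ≡ suc (lookup α i)))

sortℕ : List ℕ → List ℕ
sortℕ = IS.sort ≤-decTotalOrder

-- i (1-based) is a block start of α: a'_i = i where α↑ = (a'_1,…,a'_n)
BlockStart : List ℕ → ℕ → Set
BlockStart α i = 1 ≤ i × (sortℕ α !? (i ∸ 1)) ≡ just i

BlockOfSize : ℕ → List ℕ → ℕ → ℕ → Set
BlockOfSize n α i k =
  BlockStart α i × (∃ λ j →
      i < j
    × (BlockStart α j ⊎ j ≡ suc n)
    × (∀ m → i < m → m < j → ¬ BlockStart α m)
    × k ≡ j ∸ i)

IsUPFT2 : ℕ → (ℕ → Set) → List ℕ → Set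
IsUPFT2 n S α = IsUnitIntervalPF n α × (∀ i k → BlockOfSize n α i k → S k)

module Submission where

-- A Fubini ranking b is a tiling of the spots [1, n] by blocks: each value x occurring k times owns the
-- block [x, x + k), since exactly x − 1 entries lie below x. Send the (c+1)-th occurrence of x to the
-- preference x + (c ∸ 1), with ∸ truncated at 0. Reading b from left to right, the cars then fill the block of x
-- one spot at a time, each in its preferred spot or the next one; so the image is a unit interval parking
-- function, and its sorted block structure is exactly the tiling, with block sizes the multiplicities.
-- Conversely, running the parking process on a unit interval parking function, a car parking at its
-- preference a opens a new block at a, and one parking at a + 1 extends the block covering a; recording
-- the block each car extends rebuilds b. The same reading of preferences against the blocks seen so far
-- shows that the map is injective.

open import Defs
open import Data.Nat using (ℕ; zero; suc; _+_; _∸_; _≤_; _<_; _≟_; _<ᵇ_; _≡ᵇ_; z≤n; s≤s; _≤?_; _<?_)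
open import Data.Nat.Properties
open import Data.List using (List; []; _∷_; _++_; length; lookup; map)
open import Data.List.Properties using (length-map; ∷-injective)
open import Data.List.Membership.Propositional using (_∈_; _∉_)
open import Data.List.Membership.Propositional.Properties using (∈-lookup)
open import Data.List.Membership.DecPropositional _≟_ using (_∈?_)
open import Data.List.Relation.Unary.Any using (here; there; index)
open import Data.List.Relation.Unary.Any.Properties using (lookup-index)
open import Data.List.Relation.Unary.All as All using (All; []; _∷_)
open import Data.List.Relation.Unary.All.Properties using (All¬⇒¬Any; ¬Any⇒All¬; map⁺; map⁻)
open import Data.List.Relation.Unary.Unique.Propositional using (Unique)
open import Data.List.Relation.Unary.AllPairs using (AllPairs; []; _∷_)
open import Data.List.Relation.Unary.Linked.Properties using (Linked⇒AllPairs)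
open import Data.List.Sort.Base using (SortingAlgorithm)
import Data.List.Sort.InsertionSort as IS
open import Data.List.Relation.Binary.Permutation.Propositional as ↭ using (_↭_; prep; swap; ↭-sym; ↭-trans)
open import Data.List.Relation.Binary.Permutation.Propositional.Properties using (↭-length; shift; ++-identityʳ)
open import Data.Bool using (true; false; if_then_else_; T)
open import Data.Unit using (⊤; tt)
open import Data.Maybe using (just; nothing)
open import Data.Product using (_×_; _,_; proj₁; proj₂; ∃; Σ-syntax)
open import Data.Sum as Sum using (_⊎_; inj₁; inj₂; [_,_])
open import Data.Empty using (⊥-elim)
open import Data.Fin using (Fin; toℕ; zero; suc)
open import Relation.Nullary using (¬_; does; Dec; yes; no)
open import Relation.Nullary.Decidable using (_×-dec_)
open import Relation.Unary using (Decidable)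
open import Relation.Unary.Properties using (_∪?_)
open import Relation.Binary.PropositionalEquality hiding ([_])
open import Relation.Binary.Definitions using (tri<; tri≈; tri>)
open import Function using (_∘′_; id)
open import Induction.WellFounded using (Acc; acc)
open import Data.Nat.Induction using (<-wellFounded)

module _ {A : Set} {P : A → Set} (P? : Decidable P) where

  countWhere : List A → ℕ
  countWhere [] = 0
  countWhere (a ∷ as) = if does (P? a) then suc (countWhere as) else countWhere as

  countWhere-accept : ∀ {a} as → P a → countWhere (a ∷ as) ≡ suc (countWhere as)
  countWhere-accept {a} as p with P? a
  ... | yes _ = refl
  ... | no ¬p = ⊥-elim (¬p p)

  countWhere-reject : ∀ {a} as → ¬ P a → countWhere (a ∷ as) ≡ countWhere as
  countWhere-reject {a} as ¬p with P? a
  ... | yes p = ⊥-elim (¬p p)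
  ... | no _ = refl

  countWhere-all : ∀ {as} → All P as → countWhere as ≡ length as
  countWhere-all {[]} [] = refl
  countWhere-all {a ∷ as} (p ∷ ps) = trans (countWhere-accept as p) (cong suc (countWhere-all ps))

  countWhere-none : ∀ {as} → All (¬_ ∘′ P) as → countWhere as ≡ 0
  countWhere-none {[]} [] = refl
  countWhere-none {a ∷ as} (¬p ∷ ¬ps) = trans (countWhere-reject as ¬p) (countWhere-none ¬ps)

  countWhere-≤-length : ∀ as → countWhere as ≤ length as
  countWhere-≤-length [] = z≤n
  countWhere-≤-length (a ∷ as) with P? a
  ... | yes _ = s≤s (countWhere-≤-length as)
  ... | no _ = m≤n⇒m≤1+n (countWhere-≤-length as)

  countWhere-++ : ∀ as bs → countWhere (as ++ bs) ≡ countWhere as + countWhere bs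
  countWhere-++ [] bs = refl
  countWhere-++ (a ∷ as) bs with P? a
  ... | yes _ = cong suc (countWhere-++ as bs)
  ... | no _ = countWhere-++ as bs

  countWhere-↭ : ∀ {as bs} → as ↭ bs → countWhere as ≡ countWhere bs
  countWhere-↭ ↭.refl = refl
  countWhere-↭ (prep a p) with P? a
  ... | yes _ = cong suc (countWhere-↭ p)
  ... | no _ = countWhere-↭ p
  countWhere-↭ (swap a b p) with P? a | P? b
  ... | yes _ | yes _ = cong (suc ∘′ suc) (countWhere-↭ p)
  ... | yes _ | no _ = cong suc (countWhere-↭ p)
  ... | no _ | yes _ = cong suc (countWhere-↭ p)
  ... | no _ | no _ = countWhere-↭ p
  countWhere-↭ (↭.trans p q) = trans (countWhere-↭ p) (countWhere-↭ q)

countWhere-map : {A B : Set} {P : B → Set} (P? : Decidable P) (f : A → B) (as : List A) →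
                 countWhere P? (map f as) ≡ countWhere (λ a → P? (f a)) as
countWhere-map P? f [] = refl
countWhere-map P? f (a ∷ as) with P? (f a)
... | yes _ = cong suc (countWhere-map P? f as)
... | no _ = countWhere-map P? f as

module _ {A : Set} {P Q : A → Set} (P? : Decidable P) (Q? : Decidable Q) where

  countWhere-mono : ∀ {as} → All (λ a → P a → Q a) as → countWhere P? as ≤ countWhere Q? as
  countWhere-mono {[]} [] = z≤n
  countWhere-mono {a ∷ as} (h ∷ hs) with P? a | Q? a
  ... | yes p | yes _ = s≤s (countWhere-mono hs)
  ... | yes p | no ¬q = ⊥-elim (¬q (h p))
  ... | no _ | yes _ = m≤n⇒m≤1+n (countWhere-mono hs)
  ... | no _ | no _ = countWhere-mono hs

  countWhere-∪ : ∀ {as} → All (λ a → P a → ¬ Q a) as →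
                 countWhere (P? ∪? Q?) as ≡ countWhere P? as + countWhere Q? as
  countWhere-∪ {[]} [] = refl
  countWhere-∪ {a ∷ as} (h ∷ hs) with P? a | Q? a
  ... | yes p | yes q = ⊥-elim (h p q)
  ... | yes _ | no _ = cong suc (countWhere-∪ hs)
  ... | no _ | yes _ = trans (cong suc (countWhere-∪ hs)) (sym (+-suc _ _))
  ... | no _ | no _ = countWhere-∪ hs

countWhere-cong : {A : Set} {P Q : A → Set} (P? : Decidable P) (Q? : Decidable Q) →
                  ∀ {as} → All (λ a → (P a → Q a) × (Q a → P a)) as → countWhere P? as ≡ countWhere Q? as
countWhere-cong P? Q? hs =
  ≤-antisym (countWhere-mono P? Q? (All.map proj₁ hs)) (countWhere-mono Q? P? (All.map proj₂ hs))

count≡countWhere : ∀ x xs → count x xs ≡ countWhere (x ≟_) xs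
count≡countWhere x [] = refl
count≡countWhere x (y ∷ ys) with x ≡ᵇ y
... | true = cong suc (count≡countWhere x ys)
... | false = count≡countWhere x ys

count-here : ∀ x xs → count x (x ∷ xs) ≡ suc (count x xs)
count-here x xs = begin
  count x (x ∷ xs)              ≡⟨ count≡countWhere x (x ∷ xs) ⟩
  countWhere (x ≟_) (x ∷ xs)    ≡⟨ countWhere-accept (x ≟_) xs refl ⟩
  suc (countWhere (x ≟_) xs)    ≡⟨ cong suc (count≡countWhere x xs) ⟨
  suc (count x xs)              ∎
  where open ≡-Reasoning

count-there : ∀ {x y} xs → x ≢ y → count x (y ∷ xs) ≡ count x xs
count-there {x} {y} xs x≢y = begin
  count x (y ∷ xs)              ≡⟨ count≡countWhere x (y ∷ xs) ⟩
  countWhere (x ≟_) (y ∷ xs)    ≡⟨ countWhere-reject (x ≟_) xs x≢y ⟩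
  countWhere (x ≟_) xs          ≡⟨ count≡countWhere x xs ⟨
  count x xs                    ∎
  where open ≡-Reasoning

count-++ : ∀ x xs ys → count x (xs ++ ys) ≡ count x xs + count x ys
count-++ x xs ys = begin
  count x (xs ++ ys)                                ≡⟨ count≡countWhere x (xs ++ ys) ⟩
  countWhere (x ≟_) (xs ++ ys)                      ≡⟨ countWhere-++ (x ≟_) xs ys ⟩
  countWhere (x ≟_) xs + countWhere (x ≟_) ys       ≡⟨ cong₂ _+_ (count≡countWhere x xs) (count≡countWhere x ys) ⟨
  count x xs + count x ys                           ∎
  where open ≡-Reasoning

count-↭ : ∀ x {xs ys} → xs ↭ ys → count x xs ≡ count x ys
count-↭ x {xs} {ys} p = begin
  count x xs             ≡⟨ count≡countWhere x xs ⟩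
  countWhere (x ≟_) xs   ≡⟨ countWhere-↭ (x ≟_) p ⟩
  countWhere (x ≟_) ys   ≡⟨ count≡countWhere x ys ⟨
  count x ys             ∎
  where open ≡-Reasoning

occurs? : ∀ xs x → Dec (Occurs xs x)
occurs? xs x = 0 <? count x xs

Occurs-here : ∀ x xs → Occurs (x ∷ xs) x
Occurs-here x xs = subst (0 <_) (sym (count-here x xs)) (s≤s z≤n)

∈⇒Occurs : ∀ {x xs} → x ∈ xs → Occurs xs x
∈⇒Occurs {x} {.x ∷ xs} (here refl) = Occurs-here x xs
∈⇒Occurs {x} {y ∷ xs} (there x∈xs) with x ≟ y
... | yes refl = Occurs-here x xs
... | no x≢y = subst (0 <_) (sym (count-there xs x≢y)) (∈⇒Occurs x∈xs)

Occurs⇒∈ : ∀ {x} xs → Occurs xs x → x ∈ xs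
Occurs⇒∈ {x} (y ∷ xs) occ with x ≟ y
... | yes x≡y = here x≡y
... | no x≢y = there (Occurs⇒∈ xs (subst (0 <_) (count-there xs x≢y) occ))

∉⇒count≡0 : ∀ {x} xs → x ∉ xs → count x xs ≡ 0
∉⇒count≡0 xs x∉xs = n≤0⇒n≡0 (≮⇒≥ (x∉xs ∘′ Occurs⇒∈ xs))

IsTuple⇒All : ∀ {n xs} → IsTuple n xs → All (InRange n) xs
IsTuple⇒All {n} (_ , inRange) =
  All.tabulate (λ x∈xs → subst (InRange n) (sym (lookup-index x∈xs)) (inRange (index x∈xs)))

All⇒IsTuple : ∀ {n xs} → length xs ≡ n → All (InRange n) xs → IsTuple n xs
All⇒IsTuple length≡n inRange = length≡n , λ i → All.lookup inRange (∈-lookup i)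

inRange? : ∀ m → Decidable (InRange m)
inRange? m x = (1 ≤? x) ×-dec (x ≤? m)

unique⇒count≤1 : ∀ x {xs} → Unique xs → count x xs ≤ 1
unique⇒count≤1 x {[]} [] = z≤n
unique⇒count≤1 x {y ∷ xs} (y∉xs ∷ u) with x ≟ y
... | yes refl = ≤-reflexive (trans (count-here x xs) (cong suc (∉⇒count≡0 xs (All¬⇒¬Any y∉xs))))
... | no x≢y = subst (_≤ 1) (sym (count-there xs x≢y)) (unique⇒count≤1 x u)

unique-inRange-count≤ : ∀ m xs → Unique xs → countWhere (inRange? m) xs ≤ m
unique-inRange-count≤ zero xs u =
  ≤-reflexive (countWhere-none (inRange? 0) (All.universal (λ { x (1≤x , x≤0) → <⇒≱ 1≤x x≤0 }) xs))
unique-inRange-count≤ (suc m) xs u = begin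
  countWhere (inRange? (suc m)) xs
    ≡⟨ countWhere-cong (inRange? (suc m)) (inRange? m ∪? (suc m ≟_)) (All.universal inRange-suc xs) ⟩
  countWhere (inRange? m ∪? (suc m ≟_)) xs
    ≡⟨ countWhere-∪ (inRange? m) (suc m ≟_) (All.universal (λ { x (_ , x≤m) refl → 1+n≰n x≤m }) xs) ⟩
  countWhere (inRange? m) xs + countWhere (suc m ≟_) xs
    ≤⟨ +-mono-≤ (unique-inRange-count≤ m xs u)
                (subst (_≤ 1) (count≡countWhere (suc m) xs) (unique⇒count≤1 (suc m) u)) ⟩
  m + 1
    ≡⟨ +-comm m 1 ⟩
  suc m ∎
  where
  open ≤-Reasoning
  inRange-suc : ∀ x → (InRange (suc m) x → InRange m x ⊎ suc m ≡ x) × (InRange m x ⊎ suc m ≡ x → InRange (suc m) x)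
  inRange-suc x = to , from
    where
    to : InRange (suc m) x → InRange m x ⊎ suc m ≡ x
    to (1≤x , x≤1+m) with m<1+n⇒m<n∨m≡n (s≤s x≤1+m)
    ... | inj₁ x<1+m = inj₁ (1≤x , ≤-pred x<1+m)
    ... | inj₂ x≡1+m = inj₂ (sym x≡1+m)
    from : InRange m x ⊎ suc m ≡ x → InRange (suc m) x
    from (inj₁ (1≤x , x≤m)) = 1≤x , m≤n⇒m≤1+n x≤m
    from (inj₂ refl) = s≤s z≤n , ≤-refl

unique-inRange-length≤ : ∀ m {xs} → Unique xs → All (InRange m) xs → length xs ≤ m
unique-inRange-length≤ m {xs} u inRange =
  subst (_≤ m) (countWhere-all (inRange? m) inRange) (unique-inRange-count≤ m xs u)

countBelow countAtMost : ℕ → List ℕ → ℕ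
countBelow v = countWhere (_<? v)
countAtMost v = countWhere (_≤? v)

All-!? : ∀ {P : ℕ → Set} {xs} → All P xs → ∀ m {v} → xs !? m ≡ just v → P v
All-!? (p ∷ ps) zero refl = p
All-!? (p ∷ ps) (suc m) eq = All-!? ps m eq

sorted-!?⇒ : ∀ {L} → AllPairs _≤_ L → ∀ m {v} → L !? m ≡ just v → countBelow v L ≤ m × m < countAtMost v L
sorted-!?⇒ {y ∷ ys} (y≤ys ∷ _) zero refl
  rewrite countWhere-reject (_<? y) ys (<-irrefl refl) | countWhere-accept (_≤? y) ys (≤-refl {y}) =
  ≤-reflexive (countWhere-none (_<? y) (All.map ≤⇒≯ y≤ys)) , s≤s z≤n
sorted-!?⇒ {y ∷ ys} (y≤ys ∷ sorted) (suc m) {v} eq with sorted-!?⇒ sorted m eq | y <? v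
... | below , atMost | yes y<v
  rewrite countWhere-accept (_<? v) ys y<v | countWhere-accept (_≤? v) ys (<⇒≤ y<v) = s≤s below , s≤s atMost
... | below , atMost | no y≮v
  rewrite countWhere-reject (_<? v) ys y≮v | countWhere-accept (_≤? v) ys (All-!? y≤ys m eq) =
  m≤n⇒m≤1+n below , s≤s atMost

sorted-!?⇐ : ∀ {L} → AllPairs _≤_ L → ∀ m v → countBelow v L ≤ m → m < countAtMost v L → L !? m ≡ just v
sorted-!?⇐ {y ∷ ys} (y≤ys ∷ sorted) m v below atMost with y <? v
sorted-!?⇐ {y ∷ ys} (y≤ys ∷ sorted) zero v below atMost | yes y<v
  rewrite countWhere-accept (_<? v) ys y<v = ⊥-elim (1+n≰n (≤-trans below z≤n))
sorted-!?⇐ {y ∷ ys} (y≤ys ∷ sorted) (suc m) v below atMost | yes y<v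
  rewrite countWhere-accept (_<? v) ys y<v | countWhere-accept (_≤? v) ys (<⇒≤ y<v) =
  sorted-!?⇐ sorted m v (≤-pred below) (≤-pred atMost)
... | no y≮v with y ≤? v
...   | no y≰v
  rewrite countWhere-reject (_≤? v) ys y≰v
        | countWhere-none (_≤? v) (All.map (λ y≤z z≤v → y≰v (≤-trans y≤z z≤v)) y≤ys) =
  ⊥-elim (1+n≰n (≤-trans atMost z≤n))
sorted-!?⇐ {y ∷ ys} (y≤ys ∷ sorted) zero v below atMost | no y≮v | yes y≤v =
  cong just (≤-antisym y≤v (≮⇒≥ y≮v))
sorted-!?⇐ {y ∷ ys} (y≤ys ∷ sorted) (suc m) v below atMost | no y≮v | yes y≤v
  with refl ← ≤-antisym y≤v (≮⇒≥ y≮v)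
  rewrite countWhere-accept (_≤? y) ys (≤-refl {y}) =
  sorted-!?⇐ sorted m y (≤-trans (≤-reflexive (countWhere-none (_<? y) (All.map ≤⇒≯ y≤ys))) z≤n) (≤-pred atMost)

sortℕ-sorted : ∀ xs → AllPairs _≤_ (sortℕ xs)
sortℕ-sorted xs = Linked⇒AllPairs ≤-trans (SortingAlgorithm.sort-↗ (IS.insertionSort ≤-decTotalOrder) xs)

sortℕ-↭ : ∀ xs → sortℕ xs ↭ xs
sortℕ-↭ = SortingAlgorithm.sort-↭ (IS.insertionSort ≤-decTotalOrder)

BlockStart⇒counts : ∀ α i → BlockStart α i → 1 ≤ i × countBelow i α ≤ i ∸ 1 × i ∸ 1 < countAtMost i α
BlockStart⇒counts α i (1≤i , eq) with sorted-!?⇒ (sortℕ-sorted α) (i ∸ 1) eq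
... | below , atMost =
  1≤i , subst (_≤ i ∸ 1) (countWhere-↭ (_<? i) (sortℕ-↭ α)) below
      , subst (i ∸ 1 <_) (countWhere-↭ (_≤? i) (sortℕ-↭ α)) atMost

counts⇒BlockStart : ∀ α i → 1 ≤ i → countBelow i α ≤ i ∸ 1 → i ∸ 1 < countAtMost i α → BlockStart α i
counts⇒BlockStart α i 1≤i below atMost = 1≤i , sorted-!?⇐ (sortℕ-sorted α) (i ∸ 1) i
  (subst (_≤ i ∸ 1) (sym (countWhere-↭ (_<? i) (sortℕ-↭ α))) below)
  (subst (i ∸ 1 <_) (sym (countWhere-↭ (_≤? i) (sortℕ-↭ α))) atMost)

≤⇒<ᵇ≡false : ∀ {a n} → a ≤ n → (n <ᵇ a) ≡ false
≤⇒<ᵇ≡false {a} {n} a≤n with n <ᵇ a in n<ᵇa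
... | false = refl
... | true = ⊥-elim (≤⇒≯ a≤n (<ᵇ⇒< n a (subst T (sym n<ᵇa) tt)))

findSpot-sound : ∀ n O a fuel {s} → findSpot n O a fuel ≡ just s →
                 a ≤ s × s ≤ n × s ∉ O × (∀ t → a ≤ t → t < s → t ∈ O)
findSpot-sound n O a (suc fuel) {s} eq with n <ᵇ a in n<ᵇa
... | true with () ← eq
... | false with a ∈? O
...   | no a∉O with refl ← eq =
  ≤-refl , ≮⇒≥ (λ n<a → subst T n<ᵇa (<⇒<ᵇ n<a)) , a∉O , λ t a≤t t<a → ⊥-elim (<⇒≱ t<a a≤t)
...   | yes a∈O with findSpot-sound n O (suc a) fuel eq
...     | a<s , s≤n , s∉O , occupied = <⇒≤ a<s , s≤n , s∉O , occupied′
  where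
  occupied′ : ∀ t → a ≤ t → t < s → t ∈ O
  occupied′ t a≤t t<s with a ≟ t
  ... | yes refl = a∈O
  ... | no a≢t = occupied t (≤∧≢⇒< a≤t a≢t) t<s

findSpot-free : ∀ n O a fuel → a ≤ n → a ∉ O → findSpot n O a (suc fuel) ≡ just a
findSpot-free n O a fuel a≤n a∉O rewrite ≤⇒<ᵇ≡false a≤n with a ∈? O
... | yes a∈O = ⊥-elim (a∉O a∈O)
... | no _ = refl

findSpot-next : ∀ n O a → suc a ≤ n → a ∈ O → suc a ∉ O → findSpot n O a (suc n) ≡ just (suc a)
findSpot-next (suc n) O a a<n a∈O a+1∉O rewrite ≤⇒<ᵇ≡false (<⇒≤ a<n) with a ∈? O
... | no a∉O = ⊥-elim (a∉O a∈O)
... | yes _ = findSpot-free (suc n) O (suc a) n a<n a+1∉O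

UnitRun : ℕ → List ℕ → List ℕ → Set
UnitRun n O [] = ⊤
UnitRun n O (a ∷ as) = ∃ λ s → findSpot n O a (suc n) ≡ just s × (s ≡ a ⊎ s ≡ suc a) × UnitRun n (s ∷ O) as

UnitParks : ℕ → List ℕ → List ℕ → Set
UnitParks n O α = ∀ (i : Fin (length α)) → ∃ λ s →
  (parkAll n O α !? toℕ i) ≡ just (just s) × (s ≡ lookup α i ⊎ s ≡ suc (lookup α i))

UnitRun⇒UnitParks : ∀ n O α → UnitRun n O α → UnitParks n O α
UnitRun⇒UnitParks n O (a ∷ as) (s , eq , unit , run) i with findSpot n O a (suc n)
UnitRun⇒UnitParks n O (a ∷ as) (s , refl , unit , run) zero | just .s = s , refl , unit
UnitRun⇒UnitParks n O (a ∷ as) (s , refl , unit , run) (suc i) | just .s = UnitRun⇒UnitParks n (s ∷ O) as run i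

UnitParks⇒UnitRun : ∀ n O α → UnitParks n O α → UnitRun n O α
UnitParks⇒UnitRun n O [] parks = tt
UnitParks⇒UnitRun n O (a ∷ as) parks with findSpot n O a (suc n) | parks zero | (λ i → parks (suc i))
... | nothing | _ , () , _ | _
... | just s | .s , refl , unit | parks′ = s , refl , unit , UnitParks⇒UnitRun n (s ∷ O) as parks′

UnitRun⇒≤ : ∀ {n O α} → UnitRun n O α → All (_≤ n) α
UnitRun⇒≤ {α = []} _ = []
UnitRun⇒≤ {n} {O} {a ∷ α} (s , spot , _ , run) =
  let a≤s , s≤n , _ = findSpot-sound n O a (suc n) spot in ≤-trans a≤s s≤n ∷ UnitRun⇒≤ run

InBlock : List ℕ → ℕ → ℕ → Set
InBlock xs x s = x ≤ s × s < x + count x xs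

Covered : List ℕ → ℕ → Set
Covered xs s = ∃ λ x → InBlock xs x s

BlocksDisjoint : List ℕ → Set
BlocksDisjoint xs = ∀ z w → Occurs xs z → Occurs xs w → z < w → z + count z xs ≤ w

InBlock⇒Occurs : ∀ {xs x s} → InBlock xs x s → Occurs xs x
InBlock⇒Occurs {xs} {x} (x≤s , s<end) with count x xs
... | zero = ⊥-elim (<⇒≱ s<end (≤-trans (≤-reflexive (+-identityʳ x)) x≤s))
... | suc _ = s≤s z≤n

Occurs⇒InBlock : ∀ {xs x} → Occurs xs x → InBlock xs x x
Occurs⇒InBlock {xs} {x} x∈xs = ≤-refl , m<m+n x x∈xs

InBlock-↭ : ∀ {xs ys x s} → xs ↭ ys → InBlock xs x s → InBlock ys x s
InBlock-↭ {x = x} {s} p (x≤s , s<end) = x≤s , subst (λ k → s < x + k) (count-↭ x p) s<end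

Occurs-↭ : ∀ {xs ys x} → xs ↭ ys → Occurs xs x → Occurs ys x
Occurs-↭ {x = x} p = subst (0 <_) (count-↭ x p)

BlocksDisjoint-↭ : ∀ {xs ys} → xs ↭ ys → BlocksDisjoint xs → BlocksDisjoint ys
BlocksDisjoint-↭ p disjoint z w z∈ys w∈ys z<w =
  subst (λ k → z + k ≤ w) (count-↭ z p) (disjoint z w (Occurs-↭ (↭-sym p) z∈ys) (Occurs-↭ (↭-sym p) w∈ys) z<w)

BlocksDisjoint⇒InBlock-unique : ∀ {xs z w s} → BlocksDisjoint xs → InBlock xs z s → InBlock xs w s → z ≡ w
BlocksDisjoint⇒InBlock-unique {xs} {z} {w} disjoint z-block@(z≤s , s<z+) w-block@(w≤s , s<w+) with <-cmp z w
... | tri≈ _ z≡w _ = z≡w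
... | tri< z<w _ _ =
  ⊥-elim (<⇒≱ s<z+ (≤-trans (disjoint z w (InBlock⇒Occurs {xs} z-block) (InBlock⇒Occurs {xs} w-block) z<w) w≤s))
... | tri> _ _ w<z =
  ⊥-elim (<⇒≱ s<w+ (≤-trans (disjoint w z (InBlock⇒Occurs {xs} w-block) (InBlock⇒Occurs {xs} z-block) w<z) z≤s))

Covered-∷⁻ : ∀ x xs s → Covered (x ∷ xs) s → s ≡ x + count x xs ⊎ Covered xs s
Covered-∷⁻ x xs s (z , z≤s , s<end) with z ≟ x
... | no z≢x = inj₂ (z , z≤s , subst (λ k → s < z + k) (count-there xs z≢x) s<end)
... | yes refl with m<1+n⇒m<n∨m≡n (subst (s <_) (trans (cong (z +_) (count-here z xs)) (+-suc z _)) s<end)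
...   | inj₁ s<end′ = inj₂ (z , z≤s , s<end′)
...   | inj₂ s≡end = inj₁ s≡end

Covered-∷⁺ : ∀ x xs s → s ≡ x + count x xs ⊎ Covered xs s → Covered (x ∷ xs) s
Covered-∷⁺ x xs s (inj₁ refl) =
  x , m≤m+n x _ , subst (λ k → x + count x xs < x + k) (sym (count-here x xs)) (+-monoʳ-< x (n<1+n _))
Covered-∷⁺ x xs s (inj₂ (z , z≤s , s<end)) with z ≟ x
... | yes refl = z , z≤s , <-≤-trans s<end (+-monoʳ-≤ z (≤-trans (n≤1+n _) (≤-reflexive (sym (count-here z xs)))))
... | no z≢x = z , z≤s , subst (λ k → s < z + k) (sym (count-there xs z≢x)) s<end

BlocksDisjoint-∷ : ∀ x xs → BlocksDisjoint xs → ¬ Covered xs (x + count x xs) → BlocksDisjoint (x ∷ xs)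
BlocksDisjoint-∷ x xs disjoint end-free z w z∈ w∈ z<w with z ≟ x | w ≟ x
... | yes refl | yes refl = ⊥-elim (<-irrefl refl z<w)
... | yes refl | no w≢x rewrite count-here z xs | count-there xs w≢x = end-below-w (occurs? xs z)
  where
  end-below-w : Dec (Occurs xs z) → z + suc (count z xs) ≤ w
  end-below-w (no z∉xs) rewrite n≤0⇒n≡0 (≮⇒≥ z∉xs) = subst (_≤ w) (sym (+-comm z 1)) z<w
  end-below-w (yes z∈xs) with m≤n⇒m<n∨m≡n (disjoint z w z∈xs w∈ z<w)
  ... | inj₁ end<w = subst (_≤ w) (sym (+-suc z _)) end<w
  ... | inj₂ refl = ⊥-elim (end-free (z + count z xs , Occurs⇒InBlock {xs} w∈))
... | no z≢x | yes refl rewrite count-there xs z≢x = w-after-z (occurs? xs w)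
  where
  w-after-z : Dec (Occurs xs w) → z + count z xs ≤ w
  w-after-z (yes w∈xs) = disjoint z w z∈ w∈xs z<w
  w-after-z (no w∉xs) rewrite n≤0⇒n≡0 (≮⇒≥ w∉xs) | +-identityʳ w =
    ≮⇒≥ (λ w<end → end-free (z , <⇒≤ z<w , w<end))
... | no z≢x | no w≢x rewrite count-there xs z≢x | count-there xs w≢x = disjoint z w z∈ w∈ z<w

greatest? : ∀ {P : ℕ → Set} → Decidable P → ∀ d →
            (∃ λ z → z ≤ d × P z × (∀ w → w ≤ d → P w → w ≤ z)) ⊎ (∀ w → w ≤ d → ¬ P w)
greatest? P? zero with P? zero
... | yes p = inj₁ (zero , z≤n , p , λ w w≤0 _ → w≤0)
... | no ¬p = inj₂ (λ { zero _ → ¬p })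
greatest? P? (suc d) with P? (suc d) | greatest? P? d
... | yes p | _ = inj₁ (suc d , ≤-refl , p , λ w w≤1+d _ → w≤1+d)
... | no ¬p | inj₁ (z , z≤d , pz , greatest) =
  inj₁ (z , m≤n⇒m≤1+n z≤d , pz , λ w w≤1+d pw → greatest w (≤-pred (≤∧≢⇒< w≤1+d λ { refl → ¬p pw })) pw)
... | no ¬p | inj₂ none =
  inj₂ (λ w w≤1+d pw → none w (≤-pred (≤∧≢⇒< w≤1+d λ { refl → ¬p pw })) pw)

countBelow-suc : ∀ z xs → countBelow (suc z) xs ≡ countBelow z xs + count z xs
countBelow-suc z xs = begin
  countBelow (suc z) xs
    ≡⟨ countWhere-cong (_<? suc z) ((_<? z) ∪? (z ≟_)) (All.universal split xs) ⟩
  countWhere ((_<? z) ∪? (z ≟_)) xs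
    ≡⟨ countWhere-∪ (_<? z) (z ≟_) (All.universal (λ { v v<z refl → <-irrefl refl v<z }) xs) ⟩
  countBelow z xs + countWhere (z ≟_) xs
    ≡⟨ cong (countBelow z xs +_) (count≡countWhere z xs) ⟨
  countBelow z xs + count z xs ∎
  where
  open ≡-Reasoning
  split : ∀ v → (v < suc z → v < z ⊎ z ≡ v) × (v < z ⊎ z ≡ v → v < suc z)
  split v = (λ v<1+z → Sum.map id sym (m<1+n⇒m<n∨m≡n v<1+z)) , [ m<n⇒m<1+n , (λ { refl → n<1+n v }) ]

countBelow-gap : ∀ {z x} xs → z < x → (∀ v → z < v → v < x → ¬ Occurs xs v) →
                 countBelow x xs ≡ countBelow (suc z) xs
countBelow-gap {z} {x} xs z<x gap = countWhere-cong (_<? x) (_<? suc z) (All.tabulate same)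
  where
  same : ∀ {v} → v ∈ xs → (v < x → v < suc z) × (v < suc z → v < x)
  same v∈xs = (λ v<x → s≤s (≮⇒≥ (λ z<v → gap _ z<v v<x (∈⇒Occurs v∈xs))))
            , (λ v≤z → ≤-<-trans (≤-pred v≤z) z<x)

countBelow-mono : ∀ {x y} xs → x ≤ y → countBelow x xs ≤ countBelow y xs
countBelow-mono xs x≤y = countWhere-mono (_<? _) (_<? _) (All.universal (λ _ v<x → <-≤-trans v<x x≤y) xs)

+≡suc[∸1+] : ∀ {x} k → 1 ≤ x → x + k ≡ suc (x ∸ 1 + k)
+≡suc[∸1+] k (s≤s _) = refl

module Fubini {n} (b : List ℕ) (fr : IsFubiniRanking n b) where

  inRange : ∀ x → Occurs b x → InRange n x
  inRange x x∈b = All.lookup (IsTuple⇒All (proj₁ fr)) (Occurs⇒∈ b x∈b)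

  #below : ∀ x → Occurs b x → countBelow x b ≡ x ∸ 1
  #below x = go x (<-wellFounded x)
    where
    go : ∀ x → Acc _<_ x → Occurs b x → countBelow x b ≡ x ∸ 1
    go x (acc rec) x∈b with inRange x x∈b
    ... | s≤s {n = x′} _ , _ with greatest? (occurs? b) x′
    ...   | inj₂ none = trans (countWhere-none (_<? suc x′) (All.tabulate nothing-below)) (sym x′≡0)
      where
      nothing-below : ∀ {v} → v ∈ b → ¬ v < suc x′
      nothing-below v∈b v<x = none _ (≤-pred v<x) (∈⇒Occurs v∈b)
      x′≡0 : x′ ≡ 0
      x′≡0 = n≤0⇒n≡0 (≮⇒≥ (λ 1≤x′ → none 1 1≤x′ (proj₁ (proj₂ fr))))
    ...   | inj₁ (z , z≤x′ , z∈b , greatest) = begin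
      countBelow (suc x′) b       ≡⟨ countBelow-gap b (s≤s z≤x′) gap ⟩
      countBelow (suc z) b        ≡⟨ countBelow-suc z b ⟩
      countBelow z b + count z b  ≡⟨ cong (_+ count z b) (go z (rec (s≤s z≤x′)) z∈b) ⟩
      z ∸ 1 + count z b           ≡⟨ suc-injective next ⟨
      x′                          ∎
      where
      open ≡-Reasoning
      gap : ∀ v → z < v → v < suc x′ → ¬ Occurs b v
      gap v z<v v<x v∈b = <⇒≱ z<v (greatest v (≤-pred v<x) v∈b)
      next : suc x′ ≡ suc (z ∸ 1 + count z b)
      next = trans (proj₂ (proj₂ fr) z (suc x′) z∈b (x∈b , s≤s z≤x′ , least))
                   (+≡suc[∸1+] (count z b) (proj₁ (inRange z z∈b)))
        where
        least : ∀ w → Occurs b w → z < w → suc x′ ≤ w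
        least w w∈b z<w = ≮⇒≥ (λ w<x → gap w z<w w<x w∈b)

  block≤ : ∀ x → Occurs b x → x + count x b ≤ suc n
  block≤ x x∈b = begin
    x + count x b                    ≡⟨ +≡suc[∸1+] (count x b) (proj₁ (inRange x x∈b)) ⟩
    suc (x ∸ 1 + count x b)          ≡⟨ cong (λ k → suc (k + count x b)) (#below x x∈b) ⟨
    suc (countBelow x b + count x b) ≡⟨ cong suc (countBelow-suc x b) ⟨
    suc (countBelow (suc x) b)       ≤⟨ s≤s (countWhere-≤-length (_<? suc x) b) ⟩
    suc (length b)                   ≡⟨ cong suc (proj₁ (proj₁ fr)) ⟩
    suc n                            ∎
    where open ≤-Reasoning

  disjoint : BlocksDisjoint b
  disjoint z x z∈b x∈b z<x = begin
    z + count z b                    ≡⟨ +≡suc[∸1+] (count z b) (proj₁ (inRange z z∈b)) ⟩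
    suc (z ∸ 1 + count z b)          ≡⟨ cong (λ k → suc (k + count z b)) (#below z z∈b) ⟨
    suc (countBelow z b + count z b) ≡⟨ cong suc (countBelow-suc z b) ⟨
    suc (countBelow (suc z) b)       ≤⟨ s≤s (countBelow-mono b z<x) ⟩
    suc (countBelow x b)             ≡⟨ cong suc (#below x x∈b) ⟩
    suc (x ∸ 1)                      ≡⟨ m+[n∸m]≡n (proj₁ (inRange x x∈b)) ⟩
    x                                ∎
    where open ≤-Reasoning

block-end-occurs : ∀ {n b} → BlocksDisjoint b → (∀ s → InRange n s → Covered b s) →
                   ∀ x → Occurs b x → 1 ≤ x → x + count x b ≤ n → Occurs b (x + count x b)
block-end-occurs {n} {b} disjoint covers x x∈b 1≤x end≤n with covers (x + count x b) (≤-trans 1≤x (m≤m+n x _) , end≤n)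
... | w , w-block@(w≤end , end<w+) with <-cmp w x
...   | tri< w<x _ _ = ⊥-elim (<⇒≱ end<w+ (≤-trans (disjoint w x (InBlock⇒Occurs {b} w-block) x∈b w<x) (m≤m+n x _)))
...   | tri≈ _ refl _ = ⊥-elim (<-irrefl refl end<w+)
...   | tri> _ _ x<w =
  subst (Occurs b) (≤-antisym w≤end (disjoint x w x∈b (InBlock⇒Occurs {b} w-block) x<w)) (InBlock⇒Occurs {b} w-block)

tiling⇒fubini : ∀ {n b} → 1 ≤ n → length b ≡ n → (∀ x → Occurs b x → InRange n x) → BlocksDisjoint b →
                (∀ s → InRange n s → Covered b s) → IsFubiniRanking n b
tiling⇒fubini {n} {b} 1≤n length≡n inRange disjoint covers =
  All⇒IsTuple {xs = b} length≡n (All.tabulate (λ x∈b → inRange _ (∈⇒Occurs x∈b))) , one-occurs , next-larger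
  where
  one-occurs : Occurs b 1
  one-occurs with covers 1 (≤-refl , 1≤n)
  ... | z , z≤1 , 1<end = subst (Occurs b) (≤-antisym z≤1 (proj₁ (inRange z z∈b))) z∈b
    where
    z∈b : Occurs b z
    z∈b = InBlock⇒Occurs {b} (z≤1 , 1<end)

  next-larger : ∀ x y → Occurs b x → NextLarger b x y → y ≡ x + count x b
  next-larger x y x∈b (y∈b , x<y , least) with m≤n⇒m<n∨m≡n (disjoint x y x∈b y∈b x<y)
  ... | inj₂ end≡y = sym end≡y
  ... | inj₁ end<y = ⊥-elim (<⇒≱ end<y (least _ end∈b (m<m+n x x∈b)))
    where
    end∈b : Occurs b (x + count x b)
    end∈b = block-end-occurs {n} {b} disjoint covers x x∈b (proj₁ (inRange x x∈b))
                             (≤-trans (<⇒≤ end<y) (proj₂ (inRange y y∈b)))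

-- seen is the part of the list already read, reversed.
annotate : List ℕ → List ℕ → List (ℕ × ℕ)
annotate seen [] = []
annotate seen (x ∷ xs) = (x , count x seen) ∷ annotate (x ∷ seen) xs

preference : ℕ × ℕ → ℕ
preference (x , c) = x + (c ∸ 1)

toParking : List ℕ → List ℕ
toParking b = map preference (annotate [] b)

length-annotate : ∀ seen xs → length (annotate seen xs) ≡ length xs
length-annotate seen [] = refl
length-annotate seen (x ∷ xs) = cong suc (length-annotate (x ∷ seen) xs)

map-proj₁-annotate : ∀ seen xs → map proj₁ (annotate seen xs) ≡ xs
map-proj₁-annotate seen [] = refl
map-proj₁-annotate seen (x ∷ xs) = cong (x ∷_) (map-proj₁-annotate (x ∷ seen) xs)

length-toParking : ∀ b → length (toParking b) ≡ length b
length-toParking b = trans (length-map preference (annotate [] b)) (length-annotate [] b)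

_⊑_ : List ℕ → List ℕ → Set
xs ⊑ ys = ∀ y → count y xs ≤ count y ys

++-↭⇒⊑ : ∀ {xs ys zs} → xs ++ ys ↭ zs → xs ⊑ zs
++-↭⇒⊑ {xs} {ys} p y = subst (count y xs ≤_) (trans (sym (count-++ y xs ys)) (count-↭ y p)) (m≤m+n _ _)

++-↭⇒count< : ∀ {xs ys zs} x → xs ++ x ∷ ys ↭ zs → count x xs < count x zs
++-↭⇒count< {xs} {ys} {zs} x p = begin-strict
  count x xs                       <⟨ m<m+n _ (s≤s z≤n) ⟩
  count x xs + suc (count x ys)    ≡⟨ cong (count x xs +_) (count-here x ys) ⟨
  count x xs + count x (x ∷ ys)    ≡⟨ count-++ x xs (x ∷ ys) ⟨
  count x (xs ++ x ∷ ys)           ≡⟨ count-↭ x p ⟩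
  count x zs                       ∎
  where open ≤-Reasoning

shift-↭ : ∀ {xs ys zs : List ℕ} x → xs ++ x ∷ ys ↭ zs → (x ∷ xs) ++ ys ↭ zs
shift-↭ {xs} {ys} x p = ↭-trans (↭-sym (shift x xs ys)) p

InBlock-⊑ : ∀ {xs ys z s} → xs ⊑ ys → InBlock xs z s → InBlock ys z s
InBlock-⊑ {z = z} xs⊑ys (z≤s , s<end) = z≤s , <-≤-trans s<end (+-monoʳ-≤ z (xs⊑ys z))

BlocksDisjoint-⊑ : ∀ {xs ys} → xs ⊑ ys → BlocksDisjoint ys → BlocksDisjoint xs
BlocksDisjoint-⊑ xs⊑ys disjoint z w z∈xs w∈xs z<w =
  ≤-trans (+-monoʳ-≤ z (xs⊑ys z)) (disjoint z w (<-≤-trans z∈xs (xs⊑ys z)) (<-≤-trans w∈xs (xs⊑ys w)) z<w)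

block-end-uncovered : ∀ {seen b} x → seen ⊑ b → BlocksDisjoint b → count x seen < count x b →
                      ¬ Covered seen (x + count x seen)
block-end-uncovered {seen} {b} x seen⊑b disjoint more (z , inBlock)
  with refl ← BlocksDisjoint⇒InBlock-unique {b} disjoint (InBlock-⊑ {seen} {b} seen⊑b inBlock)
                                             (m≤m+n x _ , +-monoʳ-< x more) =
  <-irrefl refl (proj₂ inBlock)

record ParkingState (n : ℕ) (seen O : List ℕ) : Set where
  field
    occupied⇒covered : ∀ {s} → s ∈ O → Covered seen s
    covered⇒occupied : ∀ {s} → Covered seen s → s ∈ O
    occupied-inRange : All (InRange n) O
    occupied-unique : Unique O
    occupied-length : length O ≡ length seen

open ParkingState

ParkingState-[] : ∀ n → ParkingState n [] []
ParkingState-[] n = record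
  { occupied⇒covered = λ ()
  ; covered⇒occupied = λ { (x , x≤s , s<x+0) → ⊥-elim (<⇒≱ s<x+0 (≤-trans (≤-reflexive (+-identityʳ x)) x≤s)) }
  ; occupied-inRange = []
  ; occupied-unique = []
  ; occupied-length = refl
  }

ParkingState-∷ : ∀ {n seen O x} → ParkingState n seen O → let s = x + count x seen in
                 s ∉ O → InRange n s → ParkingState n (x ∷ seen) (s ∷ O)
ParkingState-∷ {n} {seen} {O} {x} st s∉O s-inRange = record
  { occupied⇒covered = λ { (here refl) → Covered-∷⁺ x seen _ (inj₁ refl)
                         ; (there t∈O) → Covered-∷⁺ x seen _ (inj₂ (occupied⇒covered st t∈O)) }
  ; covered⇒occupied = λ {t} covered →
      [ (λ { refl → here refl }) , there ∘′ covered⇒occupied st ] (Covered-∷⁻ x seen t covered)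
  ; occupied-inRange = s-inRange ∷ occupied-inRange st
  ; occupied-unique = ¬Any⇒All¬ O s∉O ∷ occupied-unique st
  ; occupied-length = cong suc (occupied-length st)
  }

-- Pigeonhole: n distinct occupied spots in [1, n] leave no spot free.
ParkingState-covers : ∀ {n seen O b} → ParkingState n seen O → seen ↭ b → length b ≡ n →
                      ∀ s → InRange n s → Covered b s
ParkingState-covers {n} {seen} {O} st p length≡n s s-inRange with s ∈? O
... | yes s∈O = let x , inBlock = occupied⇒covered st s∈O in x , InBlock-↭ p inBlock
... | no s∉O = ⊥-elim (1+n≰n (begin
  suc n          ≡⟨ cong suc (trans (occupied-length st) (trans (↭-length p) length≡n)) ⟨
  length (s ∷ O) ≤⟨ unique-inRange-length≤ n (¬Any⇒All¬ O s∉O ∷ occupied-unique st) (s-inRange ∷ occupied-inRange st) ⟩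
  n              ∎))
  where open ≤-Reasoning

ParkingState-inRange : ∀ {n seen O} → ParkingState n seen O → ∀ x → Occurs seen x → InRange n x
ParkingState-inRange {seen = seen} st x x∈seen =
  All.lookup (occupied-inRange st) (covered⇒occupied st (x , Occurs⇒InBlock {seen} x∈seen))

parks-at-block-end : ∀ {n seen O} x → ParkingState n seen O → let c = count x seen in
                     x + c ∉ O → x + c ≤ n →
                     findSpot n O (preference (x , c)) (suc n) ≡ just (x + c) ×
                     (x + c ≡ preference (x , c) ⊎ x + c ≡ suc (preference (x , c)))
parks-at-block-end {n} {seen} {O} x st end∉O end≤n with count x seen in c≡
... | zero = findSpot-free n O (x + 0) n end≤n end∉O , inj₁ refl
... | suc c = trans (findSpot-next n O (x + c) (subst (_≤ n) (+-suc x c) end≤n) x+c∈O (subst (_∉ O) (+-suc x c) end∉O))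
                    (cong just (sym (+-suc x c)))
            , inj₂ (+-suc x c)
  where
  x+c∈O : x + c ∈ O
  x+c∈O = covered⇒occupied st (x , m≤m+n x c , subst (λ k → x + c < x + k) (sym c≡) (+-monoʳ-< x (n<1+n c)))

module ToParking {n} (b : List ℕ) (fr : IsFubiniRanking n b) where
  open Fubini b fr

  run : ∀ seen rest {O} → seen ++ rest ↭ b → ParkingState n seen O →
        UnitRun n O (map preference (annotate seen rest)) ×
        (∃ λ seen′ → ∃ λ O′ → seen′ ↭ b × ParkingState n seen′ O′)
  run seen [] {O} p st = tt , seen , O , ↭-trans (↭-sym (++-identityʳ seen)) p , st
  run seen (x ∷ rest) {O} p st =
    let unitRun , final = run (x ∷ seen) rest (shift-↭ x p) (ParkingState-∷ st end∉O (1≤end , end≤n))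
        spot , unit = parks-at-block-end x st end∉O end≤n
    in (x + count x seen , spot , unit , unitRun) , final
    where
    more : count x seen < count x b
    more = ++-↭⇒count< {seen} {rest} x p
    x∈b : Occurs b x
    x∈b = ≤-<-trans z≤n more
    end∉O : x + count x seen ∉ O
    end∉O = block-end-uncovered {seen} {b} x (++-↭⇒⊑ {seen} {x ∷ rest} p) disjoint more ∘′ occupied⇒covered st
    1≤end : 1 ≤ x + count x seen
    1≤end = ≤-trans (proj₁ (inRange x x∈b)) (m≤m+n x _)
    end≤n : x + count x seen ≤ n
    end≤n = ≤-pred (≤-trans (+-monoʳ-< x more) (block≤ x x∈b))

  covers : ∀ s → InRange n s → Covered b s
  covers with run [] b ↭.refl (ParkingState-[] n)
  ... | _ , _ , _ , p , st = ParkingState-covers st p (proj₁ (proj₁ fr))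

  unitInterval : IsUnitIntervalPF n (toParking b)
  unitInterval = (tuple , λ i → let s , parked , _ = parks i in s , parked) , parks
    where
    unitRun : UnitRun n [] (toParking b)
    unitRun = proj₁ (run [] b ↭.refl (ParkingState-[] n))
    parks : UnitParks n [] (toParking b)
    parks = UnitRun⇒UnitParks n [] (toParking b) unitRun
    positive : All (1 ≤_) (toParking b)
    positive = map⁺ (All.map (λ 1≤x → ≤-trans 1≤x (m≤m+n _ _))
                 (map⁻ (subst (All (1 ≤_)) (sym (map-proj₁-annotate [] b)) (All.map proj₁ (IsTuple⇒All (proj₁ fr))))))
    tuple : IsTuple n (toParking b)
    tuple = All⇒IsTuple (trans (length-toParking b) (proj₁ (proj₁ fr))) (All.zip (positive , UnitRun⇒≤ unitRun))

-- A car that parks at its preferred spot a starts a new block at a; one that parks at a + 1 extends the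
-- block covering a, which must end exactly at a + 1.
unit-label : ∀ {n seen O a s} → ParkingState n seen O → s ∉ O → s ≡ a ⊎ (s ≡ suc a × a ∈ O) →
             ∃ λ x → preference (x , count x seen) ≡ a × s ≡ x + count x seen
unit-label {seen = seen} {a = a} st s∉O (inj₁ refl) =
  a , trans (cong (λ c → a + (c ∸ 1)) c≡0) (+-identityʳ a) , sym end≡a
  where
  c≡0 : count a seen ≡ 0
  c≡0 = n≤0⇒n≡0 (≮⇒≥ λ a∈seen → s∉O (covered⇒occupied st (a , Occurs⇒InBlock {seen} a∈seen)))
  end≡a : a + count a seen ≡ a
  end≡a = trans (cong (a +_) c≡0) (+-identityʳ a)
unit-label {seen = seen} {a = a} st s∉O (inj₂ (refl , a∈O)) with occupied⇒covered st a∈O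
... | z , z≤a , a<end = z , pref≡a , sym end≡1+a
  where
  end≡1+a : z + count z seen ≡ suc a
  end≡1+a = ≤-antisym (≮⇒≥ λ a+1<end → s∉O (covered⇒occupied st (z , m≤n⇒m≤1+n z≤a , a+1<end))) a<end
  pref≡a : z + (count z seen ∸ 1) ≡ a
  pref≡a = trans (sym (+-∸-assoc z (InBlock⇒Occurs {seen} (z≤a , a<end)))) (cong (_∸ 1) end≡1+a)

fromParking-run : ∀ {n} seen α {O} → UnitRun n O α → All (1 ≤_) α →
                  ParkingState n seen O → BlocksDisjoint seen →
                  ∃ λ rest → map preference (annotate seen rest) ≡ α ×
                  (∃ λ seen′ → ∃ λ O′ → seen′ ↭ seen ++ rest × ParkingState n seen′ O′ × BlocksDisjoint seen′)
fromParking-run seen [] {O} _ _ st disjoint = [] , refl , seen , O , ↭-sym (++-identityʳ seen) , st , disjoint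
fromParking-run {n} seen (a ∷ α) {O} (s , spot , unit , run) (1≤a ∷ 1≤α) st disjoint
  with findSpot-sound n O a (suc n) spot
... | a≤s , s≤n , s∉O , skipped
  with unit-label st s∉O (Sum.map id (λ s≡1+a → s≡1+a , skipped a ≤-refl (subst (a <_) (sym s≡1+a) (n<1+n a))) unit)
...   | x , pref≡a , refl
  with fromParking-run (x ∷ seen) α run 1≤α (ParkingState-∷ st s∉O (≤-trans 1≤a a≤s , s≤n))
                       (BlocksDisjoint-∷ x seen disjoint (s∉O ∘′ covered⇒occupied st))
...     | rest , decoded , seen′ , O′ , p , st′ , disjoint′ =
  x ∷ rest , cong₂ _∷_ pref≡a decoded , seen′ , O′ , ↭-trans p (↭-sym (shift x seen rest)) , st′ , disjoint′

fromParking : ∀ {n α} → 1 ≤ n → IsUnitIntervalPF n α → ∃ λ b → IsFubiniRanking n b × toParking b ≡ α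
fromParking {n} {α} 1≤n ((tuple , _) , parks)
  with fromParking-run [] α (UnitParks⇒UnitRun n [] α parks) (All.map proj₁ (IsTuple⇒All tuple))
                       (ParkingState-[] n) (λ _ _ ())
... | b , decoded , _ , _ , p , st , disjoint =
  b , tiling⇒fubini {n} {b} 1≤n length≡n inRange (BlocksDisjoint-↭ p disjoint) (ParkingState-covers st p length≡n)
    , decoded
  where
  inRange : ∀ x → Occurs b x → InRange n x
  inRange x x∈b = ParkingState-inRange st x (Occurs-↭ (↭-sym p) x∈b)
  length≡n : length b ≡ n
  length≡n = trans (sym (length-toParking b)) (trans (cong length decoded) (proj₁ tuple))

annotate-bound : ∀ seen xs → All (λ p → proj₂ p < count (proj₁ p) (seen ++ xs)) (annotate seen xs)
annotate-bound seen [] = []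
annotate-bound seen (x ∷ xs) =
  ++-↭⇒count< {seen} {xs} x ↭.refl
  ∷ All.map (λ {p} → subst (proj₂ p <_) (count-↭ (proj₁ p) (shift-↭ {seen} {xs} x ↭.refl)))
            (annotate-bound (x ∷ seen) xs)

countWhere-annotate : ∀ {Q : ℕ → Set} (Q? : Decidable Q) seen xs →
                      countWhere (λ p → Q? (proj₁ p)) (annotate seen xs) ≡ countWhere Q? xs
countWhere-annotate Q? seen xs =
  trans (sym (countWhere-map Q? proj₁ (annotate seen xs))) (cong (countWhere Q?) (map-proj₁-annotate seen xs))

IndexBelow : ℕ → ℕ → ℕ × ℕ → Set
IndexBelow y m (x , c) = x ≡ y × c < m

indexBelow? : ∀ y m → Decidable (IndexBelow y m)
indexBelow? y m (x , c) = (x ≟ y) ×-dec (c <? m)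

-- The occurrences of y in xs are annotated with the consecutive indices count y seen, count y seen + 1, ...
annotate-indices : ∀ y m seen xs → m ≤ count y (seen ++ xs) →
                   m ≤ countWhere (indexBelow? y m) (annotate seen xs) + count y seen
annotate-indices y m seen [] m≤ = subst (m ≤_) (trans (count-++ y seen []) (+-comm (count y seen) 0)) m≤
annotate-indices y m seen (x ∷ xs) m≤
  with x ≟ y | annotate-indices y m (x ∷ seen) xs (subst (m ≤_) (sym (count-↭ y (shift-↭ {seen} {xs} x ↭.refl))) m≤)
... | yes refl | ih with count x seen <? m
...   | yes c<m rewrite countWhere-accept (indexBelow? x m) {x , count x seen} (annotate (x ∷ seen) xs) (refl , c<m) =
  subst (m ≤_) (trans (cong (countWhere (indexBelow? x m) (annotate (x ∷ seen) xs) +_) (count-here x seen)) (+-suc _ _)) ih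
...   | no c≮m = ≤-trans (≮⇒≥ c≮m) (m≤n+m _ _)
annotate-indices y m seen (x ∷ xs) m≤ | no x≢y | ih
  rewrite countWhere-reject (indexBelow? y m) {x , count x seen} (annotate (x ∷ seen) xs) (x≢y ∘′ proj₁) =
  subst (m ≤_) (cong (countWhere (indexBelow? y m) (annotate (x ∷ seen) xs) +_) (count-there seen (x≢y ∘′ sym))) ih

module BlocksOfToParking {n} (b : List ℕ) (fr : IsFubiniRanking n b) where
  open Fubini b fr
  open ToParking b fr using (covers)

  α : List ℕ
  α = toParking b

  ann : List (ℕ × ℕ)
  ann = annotate [] b

  index-bound : All (λ p → proj₂ p < count (proj₁ p) b) ann
  index-bound = annotate-bound [] b

  preference-inBlock : ∀ {x c} → c < count x b → InBlock b x (preference (x , c))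
  preference-inBlock {x} {c} c<k = m≤m+n x _ , +-monoʳ-< x (≤-<-trans (m∸n≤m c 1) c<k)

  InBlock-below : ∀ {x s i} → InBlock b x s → Occurs b i → x < i → s < i
  InBlock-below {x} inBlock i∈b x<i =
    <-≤-trans (proj₂ inBlock) (disjoint x _ (InBlock⇒Occurs {b} inBlock) i∈b x<i)

  countBelow-α : ∀ i → Occurs b i → countBelow i α ≡ i ∸ 1
  countBelow-α i i∈b = begin
    countBelow i α
      ≡⟨ countWhere-map (_<? i) preference ann ⟩
    countWhere (λ p → preference p <? i) ann
      ≡⟨ countWhere-cong (λ p → preference p <? i) (λ p → proj₁ p <? i) (All.map same index-bound) ⟩
    countWhere (λ p → proj₁ p <? i) ann
      ≡⟨ countWhere-annotate (_<? i) [] b ⟩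
    countBelow i b
      ≡⟨ #below i i∈b ⟩
    i ∸ 1 ∎
    where
    open ≡-Reasoning
    same : ∀ {p} → proj₂ p < count (proj₁ p) b → (preference p < i → proj₁ p < i) × (proj₁ p < i → preference p < i)
    same c<k = ≤-<-trans (m≤m+n _ _) , InBlock-below (preference-inBlock c<k) i∈b

  countAtMost-α : ∀ i → Occurs b i → i ∸ 1 < countAtMost i α
  countAtMost-α i i∈b = begin-strict
    i ∸ 1
      ≡⟨ countBelow-α i i∈b ⟨
    countBelow i α
      ≡⟨ countWhere-map (_<? i) preference ann ⟩
    countWhere below? ann
      <⟨ m<m+n _ (≤-trans (annotate-indices i 1 [] b i∈b) (≤-reflexive (+-identityʳ _))) ⟩
    countWhere below? ann + countWhere (indexBelow? i 1) ann
      ≡⟨ countWhere-∪ below? (indexBelow? i 1) (All.universal disjoint′ ann) ⟨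
    countWhere (below? ∪? indexBelow? i 1) ann
      ≤⟨ countWhere-mono _ (λ p → preference p ≤? i) (All.universal (λ p → [ <⇒≤ , first ]) ann) ⟩
    countWhere (λ p → preference p ≤? i) ann
      ≡⟨ countWhere-map (_≤? i) preference ann ⟨
    countAtMost i α ∎
    where
    open ≤-Reasoning
    below? : Decidable (λ p → preference p < i)
    below? p = preference p <? i
    disjoint′ : ∀ p → preference p < i → ¬ IndexBelow i 1 p
    disjoint′ (x , zero) x+0<x (refl , _) = <-irrefl (+-identityʳ x) x+0<x
    disjoint′ (x , suc c) _ (_ , s≤s ())
    first : ∀ {p} → IndexBelow i 1 p → preference p ≤ i
    first {x , zero} (refl , _) = ≤-reflexive (+-identityʳ x)
    first {x , suc c} (_ , s≤s ())

  -- A spot i that starts no block lies inside the block of some x < i, and the first i − x + 1 entries of that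
  -- block prefer spots below i.
  i≤countBelow-α : ∀ i → InRange n i → ¬ Occurs b i → i ≤ countBelow i α
  i≤countBelow-α i i-inRange i∉b with covers i i-inRange
  ... | x , x≤i , i<end = begin
    i
      ≡⟨ i≡ ⟩
    x ∸ 1 + m
      ≤⟨ +-mono-≤ (≤-reflexive (sym (#below x x∈b))) m≤ ⟩
    countBelow x b + countWhere (indexBelow? x m) ann
      ≡⟨ cong (_+ countWhere (indexBelow? x m) ann) (countWhere-annotate (_<? x) [] b) ⟨
    countWhere before? ann + countWhere (indexBelow? x m) ann
      ≡⟨ countWhere-∪ before? (indexBelow? x m) (All.universal (λ { p y<x (refl , _) → <-irrefl refl y<x }) ann) ⟨
    countWhere (before? ∪? indexBelow? x m) ann
      ≤⟨ countWhere-mono _ (λ p → preference p <? i) (All.map below index-bound) ⟩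
    countWhere (λ p → preference p <? i) ann
      ≡⟨ countWhere-map (_<? i) preference ann ⟨
    countBelow i α ∎
    where
    open ≤-Reasoning
    before? : Decidable (λ p → proj₁ p < x)
    before? p = proj₁ p <? x
    x∈b : Occurs b x
    x∈b = InBlock⇒Occurs {b} (x≤i , i<end)
    x<i : x < i
    x<i = ≤∧≢⇒< x≤i (λ { refl → i∉b x∈b })
    m : ℕ
    m = suc (i ∸ x)
    m≤ : m ≤ countWhere (indexBelow? x m) ann
    m≤ = ≤-trans (annotate-indices x m [] b (subst (i ∸ x <_) (m+n∸m≡n x (count x b)) (∸-monoˡ-< i<end x≤i)))
                 (≤-reflexive (+-identityʳ _))
    i≡ : i ≡ x ∸ 1 + m
    i≡ = begin-equality
      i                     ≡⟨ m+[n∸m]≡n x≤i ⟨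
      x + (i ∸ x)           ≡⟨ +≡suc[∸1+] (i ∸ x) (proj₁ (inRange x x∈b)) ⟩
      suc (x ∸ 1 + (i ∸ x)) ≡⟨ +-suc (x ∸ 1) (i ∸ x) ⟨
      x ∸ 1 + m             ∎
    below : ∀ {p} → proj₂ p < count (proj₁ p) b → (proj₁ p < x ⊎ IndexBelow x m p) → preference p < i
    below c<k (inj₁ y<x) = <-≤-trans (InBlock-below (preference-inBlock c<k) x∈b y<x) x≤i
    below {.x , zero} _ (inj₂ (refl , _)) = subst (_< i) (sym (+-identityʳ x)) x<i
    below {.x , suc c} _ (inj₂ (refl , s≤s c≤i∸x)) = subst (x + c <_) (m+[n∸m]≡n x≤i) (+-monoʳ-< x c≤i∸x)

  BlockStart⇒Occurs : ∀ i → BlockStart α i → Occurs b i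
  BlockStart⇒Occurs i start with BlockStart⇒counts α i start
  ... | 1≤i , below , atMost with occurs? b i
  ...   | yes i∈b = i∈b
  ...   | no i∉b = ⊥-elim (<-irrefl refl (begin-strict
    i ∸ 1          <⟨ n<1+n (i ∸ 1) ⟩
    suc (i ∸ 1)    ≡⟨ m+[n∸m]≡n 1≤i ⟩
    i              ≤⟨ i≤countBelow-α i (1≤i , i≤n) i∉b ⟩
    countBelow i α ≤⟨ below ⟩
    i ∸ 1          ∎))
    where
    open ≤-Reasoning
    i≤n : i ≤ n
    i≤n = begin
      i                  ≡⟨ m+[n∸m]≡n 1≤i ⟨
      suc (i ∸ 1)        ≤⟨ atMost ⟩
      countAtMost i α    ≤⟨ countWhere-≤-length (_≤? i) α ⟩
      length α           ≡⟨ length-toParking b ⟩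
      length b           ≡⟨ proj₁ (proj₁ fr) ⟩
      n                  ∎

  Occurs⇒BlockStart : ∀ i → Occurs b i → BlockStart α i
  Occurs⇒BlockStart i i∈b =
    counts⇒BlockStart α i (proj₁ (inRange i i∈b)) (≤-reflexive (countBelow-α i i∈b)) (countAtMost-α i i∈b)

  BlockOfSize⇒ : ∀ i k → BlockOfSize n α i k → Occurs b i × k ≡ count i b
  BlockOfSize⇒ i k (start , j , i<j , j-start , none-between , k≡j∸i) =
    i∈b , trans k≡j∸i (trans (cong (_∸ i) j≡end) (m+n∸m≡n i _))
    where
    i∈b : Occurs b i
    i∈b = BlockStart⇒Occurs i start
    end≤j : i + count i b ≤ j
    end≤j = [ (λ start → disjoint i j i∈b (BlockStart⇒Occurs j start) i<j) , (λ { refl → block≤ i i∈b }) ] j-start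
    j≤1+n : j ≤ suc n
    j≤1+n = [ (λ start → m≤n⇒m≤1+n (proj₂ (inRange j (BlockStart⇒Occurs j start)))) , ≤-reflexive ] j-start
    j≡end : j ≡ i + count i b
    j≡end with m≤n⇒m<n∨m≡n end≤j
    ... | inj₂ end≡j = sym end≡j
    ... | inj₁ end<j = ⊥-elim (none-between _ (m<m+n i i∈b) end<j (Occurs⇒BlockStart _
            (block-end-occurs {n} {b} disjoint covers i i∈b (proj₁ (inRange i i∈b)) (≤-pred (<-≤-trans end<j j≤1+n)))))

  Occurs⇒BlockOfSize : ∀ x → Occurs b x → BlockOfSize n α x (count x b)
  Occurs⇒BlockOfSize x x∈b =
    Occurs⇒BlockStart x x∈b , x + count x b , m<m+n x x∈b , end-start ,
    (λ m x<m m<end start → <⇒≱ m<end (disjoint x m x∈b (BlockStart⇒Occurs m start) x<m)) , sym (m+n∸m≡n x _)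
    where
    end-start : BlockStart α (x + count x b) ⊎ x + count x b ≡ suc n
    end-start with m≤n⇒m<n∨m≡n (block≤ x x∈b)
    ... | inj₁ end<1+n = inj₁ (Occurs⇒BlockStart _ (block-end-occurs {n} {b} disjoint covers x x∈b (proj₁ (inRange x x∈b)) (≤-pred end<1+n)))
    ... | inj₂ end≡1+n = inj₂ end≡1+n

-- The value read back from a preference a: a fresh value a, or the value whose block covers a.
Label : List ℕ → ℕ → ℕ → Set
Label seen a x = (x ≡ a × ¬ Covered seen a) ⊎ InBlock seen x a

Label-unique : ∀ {seen a x x′} → BlocksDisjoint seen → Label seen a x → Label seen a x′ → x ≡ x′
Label-unique _ (inj₁ (refl , _)) (inj₁ (refl , _)) = refl
Label-unique _ (inj₁ (_ , uncovered)) (inj₂ inBlock) = ⊥-elim (uncovered (_ , inBlock))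
Label-unique _ (inj₂ inBlock) (inj₁ (_ , uncovered)) = ⊥-elim (uncovered (_ , inBlock))
Label-unique {seen} disjoint (inj₂ inBlock) (inj₂ inBlock′) = BlocksDisjoint⇒InBlock-unique {seen} disjoint inBlock inBlock′

preference-Label : ∀ {seen b} x → seen ⊑ b → BlocksDisjoint b → count x seen < count x b →
                   Label seen (preference (x , count x seen)) x
preference-Label {seen} {b} x seen⊑b disjoint more with count x seen in c≡
... | zero = inj₁ (sym (+-identityʳ x) , subst (λ k → ¬ Covered seen (x + k)) c≡ uncovered)
  where
  uncovered : ¬ Covered seen (x + count x seen)
  uncovered = block-end-uncovered {seen} {b} x seen⊑b disjoint (subst (_< count x b) (sym c≡) more)
... | suc c = inj₂ (m≤m+n x c , +-monoʳ-< x (n<1+n c))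

preference-injective : ∀ {seen b b′} x x′ → seen ⊑ b → seen ⊑ b′ → BlocksDisjoint b → BlocksDisjoint b′ →
                       count x seen < count x b → count x′ seen < count x′ b′ →
                       preference (x , count x seen) ≡ preference (x′ , count x′ seen) → x ≡ x′
preference-injective {seen} {b} {b′} x x′ seen⊑b seen⊑b′ disjoint disjoint′ more more′ eq =
  Label-unique {seen} (BlocksDisjoint-⊑ {seen} {b} seen⊑b disjoint)
    (preference-Label {seen} {b} x seen⊑b disjoint more)
    (subst (λ a → Label seen a x′) (sym eq) (preference-Label {seen} {b′} x′ seen⊑b′ disjoint′ more′))

toParking-injective-from : ∀ {b b′} → BlocksDisjoint b → BlocksDisjoint b′ → ∀ seen {xs xs′} →
                           seen ++ xs ↭ b → seen ++ xs′ ↭ b′ →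
                           map preference (annotate seen xs) ≡ map preference (annotate seen xs′) → xs ≡ xs′
toParking-injective-from _ _ seen {[]} {[]} _ _ _ = refl
toParking-injective-from {b} {b′} disjoint disjoint′ seen {x ∷ xs} {x′ ∷ xs′} p p′ eq
  with head≡ , tail≡ ← ∷-injective eq
  with refl ← preference-injective {seen} {b} {b′} x x′ (++-↭⇒⊑ {seen} p) (++-↭⇒⊑ {seen} p′) disjoint disjoint′
                (++-↭⇒count< {seen} {xs} x p) (++-↭⇒count< {seen} {xs′} x′ p′) head≡ =
  cong (x ∷_) (toParking-injective-from disjoint disjoint′ (x ∷ seen) (shift-↭ {seen} x p) (shift-↭ {seen} x p′) tail≡)

toParking-injective : ∀ {n} b b′ → IsFubiniRanking n b → IsFubiniRanking n b′ → toParking b ≡ toParking b′ → b ≡ b′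
toParking-injective b b′ fr fr′ =
  toParking-injective-from {b} {b′} (Fubini.disjoint b fr) (Fubini.disjoint b′ fr′) [] ↭.refl ↭.refl

theorem4p6 : (n : ℕ) → 1 ≤ n → (S : ℕ → Set) → (∀ k → S k → 1 ≤ k) →
    Σ[ f ∈ (List ℕ → List ℕ) ]
        (∀ b → IsFRT2 n S b → IsUPFT2 n S (f b))
      × (∀ b b′ → IsFRT2 n S b → IsFRT2 n S b′ → f b ≡ f b′ → b ≡ b′)
      × (∀ α → IsUPFT2 n S α → ∃ λ b → IsFRT2 n S b × f b ≡ α)
theorem4p6 n 1≤n S _ = toParking , into , injective , onto
  where
  into : ∀ b → IsFRT2 n S b → IsUPFT2 n S (toParking b)
  into b (fr , sizes) = ToParking.unitInterval b fr , λ i k block →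
    let i∈b , k≡ = BlocksOfToParking.BlockOfSize⇒ b fr i k block in subst S (sym k≡) (sizes i i∈b)

  injective : ∀ b b′ → IsFRT2 n S b → IsFRT2 n S b′ → toParking b ≡ toParking b′ → b ≡ b′
  injective b b′ (fr , _) (fr′ , _) = toParking-injective b b′ fr fr′

  onto : ∀ α → IsUPFT2 n S α → ∃ λ b → IsFRT2 n S b × toParking b ≡ α
  onto α (upf , sizes) with fromParking {n} {α} 1≤n upf
  ... | b , fr , refl = b , (fr , λ x x∈b → sizes x (count x b) (BlocksOfToParking.Occurs⇒BlockOfSize b fr x x∈b)) , refl
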